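{- For one-hole contexts $\Theta\{\}$ and $\Xi\{\}$, if $\Theta\{*\}\sim\Xi\{*\}$ (treating $*$ as a leaf), then $\overline{\Theta\{*\}}\equiv\overline{\Xi\{*\}}$.
   Context: Structures over formulas: $\Gamma::=\varnothing\mid F\mid(\Gamma,\Gamma)$, identified modulo $(\varnothing,\Gamma)=(\Gamma,\varnothing)=\Gamma$; $\equiv$ denotes syntactic identity of structures (modulo this identification). A one-hole context $\Theta\{\}$ is a structure with one leaf replaced by a hole; $\Theta\{*\}$ treats the hole as a special leaf $*$. Structural equivalence $\sim$ is the reflexive, symmetric, transitive closure of the relations $(\Gamma,\Delta)\sim(\Delta,\Gamma)$ and $(\Gamma,(\Delta,\Pi))\sim((\Gamma,\Delta),\Pi)$ applied to the whole structure (top level only, not inside substructures). The designated structure $\overline{\Theta\{*\}}$ is defined recursively: $\overline{(R\{*\},\Delta)}:=\overline{(\Delta,R\{*\})}$ (hole in left component); $\overline{(\Gamma,(\Delta,P\{*\}))}:=\overline{((\Gamma,\Delta),P\{*\})}$; $\overline{(\Gamma,(D\{*\},\Pi))}:=\overline{((\Pi,\Gamma),D\{*\})}$; $\overline{(\Gamma,*)}:=\Gamma$; $\overline{*}:=\varnothing$. -}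

module Defs where

open import Data.Sum using (_⊎_; inj₁; inj₂)
open import Data.Unit using (⊤; tt)

-- Structures modulo (∅,Γ) = (Γ,∅) = Γ are represented in normal form:
-- either ∅ or a nonempty tree containing no ∅; syntactic identity ≡
-- (modulo the unit identification) is then propositional equality.
data Tree (A : Set) : Set where
  leaf : A → Tree A
  _,,_ : Tree A → Tree A → Tree A

infixr 5 _,,_

data Struct (F : Set) : Set where
  ∅  : Struct F
  ne : Tree F → Struct F

data Ctx (F : Set) : Set where
  hole : Ctx F
  ctxL : Ctx F → Tree F → Ctx F
  ctxR : Tree F → Ctx F → Ctx F

-- Θ{*}: the hole treated as a special leaf * (= inj₂ tt).
Leaf : Set → Set
Leaf F = F ⊎ ⊤

embed : {F : Set} → Tree F → Tree (Leaf F)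
embed (leaf f) = leaf (inj₁ f)
embed (s ,, t) = embed s ,, embed t

plug* : {F : Set} → Ctx F → Tree (Leaf F)
plug* hole       = leaf (inj₂ tt)
plug* (ctxL C Δ) = plug* C ,, embed Δ
plug* (ctxR Γ C) = embed Γ ,, plug* C

-- Structural equivalence: reflexive, symmetric, transitive closure of
-- commutativity and associativity applied at top level only.
data _∼_ {A : Set} : Tree A → Tree A → Set where
  ∼-refl  : ∀ {Γ} → Γ ∼ Γ
  ∼-sym   : ∀ {Γ Δ} → Γ ∼ Δ → Δ ∼ Γ
  ∼-trans : ∀ {Γ Δ Π} → Γ ∼ Δ → Δ ∼ Π → Γ ∼ Π
  ∼-comm  : ∀ {Γ Δ} → (Γ ,, Δ) ∼ (Δ ,, Γ)
  ∼-assoc : ∀ {Γ Δ Π} → (Γ ,, (Δ ,, Π)) ∼ ((Γ ,, Δ) ,, Π)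

infix 4 _∼_

-- Designated structure, following the paper's recursive clauses:
--   overline (Γ,*)           = Γ
--   overline (Γ,(Δ,P{*}))    = overline ((Γ,Δ),P{*})
--   overline (Γ,(D{*},Π))    = overline ((Π,Γ),D{*})
-- (ovR Γ C computes overline (Γ, C{*}))
ovR : {F : Set} → Tree F → Ctx F → Tree F
ovR Γ hole       = Γ
ovR Γ (ctxR Δ P) = ovR (Γ ,, Δ) P
ovR Γ (ctxL D Π) = ovR (Π ,, Γ) D

--   overline *          = ∅
--   overline (R{*},Δ)   = overline (Δ,R{*})
designated : {F : Set} → Ctx F → Struct F
designated hole       = ∅
designated (ctxR Γ C) = ne (ovR Γ C)
designated (ctxL R Δ) = ne (ovR Δ R)

{-# OPTIONS --safe #-}
module Submission where

-- Every generating step of ∼ (commutativity or associativity at the top of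
-- Θ{*}) turns Θ into a context Ξ whose designated structure is computed by
-- one of the recursive clauses defining it, so the two are definitionally
-- equal. Following a derivation of Θ{*} ∼ Ξ{*} therefore reaches a context
-- with plug Ξ{*} and the designated structure of Θ; as plug* is injective,
-- that context is Ξ.

open import Defs
open import Data.Empty using (⊥-elim)
open import Data.Product using (_×_; _,_; proj₁; proj₂; ∃-syntax)
open import Relation.Binary.PropositionalEquality
  using (_≡_; _≢_; refl; sym; trans; cong; cong₂)

private
  variable
    F : Set
    A : Set

,,-injective : {a b c d : Tree A} → (a ,, b) ≡ (c ,, d) → a ≡ c × b ≡ d
,,-injective refl = refl , refl

embed-injective : (a b : Tree F) → embed a ≡ embed b → a ≡ b
embed-injective (leaf x) (leaf .x) refl = refl
embed-injective (a₁ ,, a₂) (b₁ ,, b₂) e =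
  cong₂ _,,_ (embed-injective a₁ b₁ (proj₁ (,,-injective e)))
             (embed-injective a₂ b₂ (proj₂ (,,-injective e)))

embed≢plug* : (a : Tree F) (C : Ctx F) → embed a ≢ plug* C
embed≢plug* (leaf _)   hole       ()
embed≢plug* (_ ,, _)   hole       ()
embed≢plug* (a₁ ,, _)  (ctxL C _) e = embed≢plug* a₁ C (proj₁ (,,-injective e))
embed≢plug* (_ ,, a₂)  (ctxR _ C) e = embed≢plug* a₂ C (proj₂ (,,-injective e))

plug*-injective : (C D : Ctx F) → plug* C ≡ plug* D → C ≡ D
plug*-injective hole hole _ = refl
plug*-injective (ctxL C a) (ctxL D b) e =
  cong₂ ctxL (plug*-injective C D (proj₁ (,,-injective e)))
             (embed-injective a b (proj₂ (,,-injective e)))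
plug*-injective (ctxR a C) (ctxR b D) e =
  cong₂ ctxR (embed-injective a b (proj₁ (,,-injective e)))
             (plug*-injective C D (proj₂ (,,-injective e)))
plug*-injective (ctxL C _) (ctxR b _) e =
  ⊥-elim (embed≢plug* b C (sym (proj₁ (,,-injective e))))
plug*-injective (ctxR a _) (ctxL D _) e =
  ⊥-elim (embed≢plug* a D (proj₁ (,,-injective e)))

DesignatedPreserving : Tree (Leaf F) → Tree (Leaf F) → Set
DesignatedPreserving {F} T U =
  (Θ : Ctx F) → plug* Θ ≡ T → ∃[ Ξ ] plug* Ξ ≡ U × designated Θ ≡ designated Ξ

preserving-refl : {T : Tree (Leaf F)} → DesignatedPreserving T T
preserving-refl Θ e = Θ , e , refl

preserving-trans : {T U V : Tree (Leaf F)} →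
  DesignatedPreserving T U → DesignatedPreserving U V → DesignatedPreserving T V
preserving-trans T⇒U U⇒V Θ e with T⇒U Θ e
... | Ψ , e′ , Θ≡Ψ with U⇒V Ψ e′
...   | Ξ , e″ , Ψ≡Ξ = Ξ , e″ , trans Θ≡Ψ Ψ≡Ξ

comm-preserving : {Γ Δ : Tree (Leaf F)} → DesignatedPreserving (Γ ,, Δ) (Δ ,, Γ)
comm-preserving (ctxL C D) refl = ctxR D C , refl , refl
comm-preserving (ctxR G C) refl = ctxL C G , refl , refl

assoc-preserving : {Γ Δ Π : Tree (Leaf F)} →
  DesignatedPreserving (Γ ,, (Δ ,, Π)) ((Γ ,, Δ) ,, Π)
assoc-preserving (ctxL C (a ,, b))   refl = ctxL (ctxL C a) b , refl , refl
assoc-preserving (ctxR G (ctxL C D)) refl = ctxL (ctxR G C) D , refl , refl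
assoc-preserving (ctxR G (ctxR D C)) refl = ctxR (G ,, D) C , refl , refl

assoc⁻¹-preserving : {Γ Δ Π : Tree (Leaf F)} →
  DesignatedPreserving ((Γ ,, Δ) ,, Π) (Γ ,, (Δ ,, Π))
assoc⁻¹-preserving (ctxL (ctxL C D) P) refl = ctxL C (D ,, P) , refl , refl
assoc⁻¹-preserving (ctxL (ctxR G C) P) refl = ctxR G (ctxL C P) , refl , refl
assoc⁻¹-preserving (ctxR (a ,, b) C)   refl = ctxR a (ctxR b C) , refl , refl

∼⇒preserving : {T U : Tree (Leaf F)} →
  T ∼ U → DesignatedPreserving T U × DesignatedPreserving U T
∼⇒preserving ∼-refl        = preserving-refl , preserving-refl
∼⇒preserving (∼-sym p)     = proj₂ (∼⇒preserving p) , proj₁ (∼⇒preserving p)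
∼⇒preserving (∼-trans p q) =
  preserving-trans (proj₁ (∼⇒preserving p)) (proj₁ (∼⇒preserving q)) ,
  preserving-trans (proj₂ (∼⇒preserving q)) (proj₂ (∼⇒preserving p))
∼⇒preserving ∼-comm        = comm-preserving , comm-preserving
∼⇒preserving ∼-assoc       = assoc-preserving , assoc⁻¹-preserving

lemma2p2 : {F : Set} (Θ Ξ : Ctx F) → plug* Θ ∼ plug* Ξ → designated Θ ≡ designated Ξ
lemma2p2 Θ Ξ Θ∼Ξ with proj₁ (∼⇒preserving Θ∼Ξ) Θ refl
... | Ψ , plugΨ≡plugΞ , Θ≡Ψ =
  trans Θ≡Ψ (cong designated (plug*-injective Ψ Ξ plugΨ≡plugΞ))
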